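{- Let $(x_0,y_0),(x_1,y_1),\dots$ be the solutions in $\mathbb{N}$ of $x^2-19\,y^2=1$, listed so that $y_0<y_1<\cdots$ (so $x_1=170$, $y_1=39$); $39$ divides every $y_k$. Call a positive integer representable if it can be written as $w^2+w\,t+5\,t^2$ with $w,t\in\mathbb{Z}$. Suppose that $y_n/39$ is representable for some integer $n>0$ that is not a power of $2$. Then the system \[\begin{cases} X^2-19\cdot 39^2\cdot Y^2=1,\\ X+13^2\cdot Y=r^2+r\,s+5\,s^2,\\ X+19\cdot 3^2\cdot Y=v^2+v\,u+5\,u^2,\\ Y>0\end{cases}\] has a solution $\bar X,\bar Y,\bar r,\bar s,\bar v,\bar u\in\mathbb{Z}$ such that $\bar r\neq\pm1$ or $\bar s\neq 0$, and moreover $39\cdot(\bar X+13^2\bar Y)\cdot(\bar X+19\cdot 3^2\,\bar Y)$ divides $y_n$. -}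

module Defs where

open import Data.Nat using (ℕ)
open import Data.Integer using (ℤ; _+_; _*_; _>_; +_)
open import Data.Product using (∃-syntax; _×_)
open import Relation.Binary.PropositionalEquality using (_≡_)

Q : ℤ → ℤ → ℤ
Q w t = w * w + w * t + + 5 * (t * t)

Representable : ℤ → Set
Representable m = m > + 0 × ∃[ w ] ∃[ t ] m ≡ Q w t

-- The solutions of x² − 19 y² = 1 are the pairs (X j, 39 Z j), where X j + Z j √28899 = (170 + √28899) ^ j
-- (descent by the fundamental solution (170, 39)), so y n = 39 Z n. Write n = 2^a (2K + 1) with K ≥ 1. Repeated
-- doubling, Z (2N) = 2 Z N X N, gives Z n = Z (2K + 1) C with C coprime to Z (2K + 1), and
-- Z (2K + 1) = (X K + 169 Z K) (X K + 171 Z K) with coprime factors.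
-- The form Q(w, t) = w² + w t + 5 t² has discriminant −19 and class number one: a prime dividing Q(w, t) but not
-- both w and t is represented by Q (Thue's lemma gives a small multiple of it that is), and dividing a value of Q
-- by a represented prime leaves a value of Q. By induction on the number of prime factors, a factor of a value of Q
-- that is coprime to its cofactor is itself a value of Q. Applied to Z n = y n / 39 this represents both
-- X K + 169 Z K and X K + 171 Z K, so (X, Y) = (X K, Z K) solves the system.
module Submission where

open import Defs
open import Data.Nat as ℕ using (ℕ; zero; suc; _^_; z≤n; s≤s)
import Data.Nat.Properties as ℕ
import Data.Nat.Divisibility as ℕ
open import Data.Nat.Coprimality using (Coprime; coprime-divisor) renaming (sym to Coprime-sym)
open import Data.Nat.Induction using (<-wellFounded)
open import Data.Nat.Primality
  using (Prime; euclidsLemma; prime⇒irreducible; ¬prime[0]; ¬prime[1]; prime?; prime⇒nonZero; prime⇒nonTrivial;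
         prime[2]; ¬prime⇒composite; composite)
open import Induction.WellFounded using (Acc; acc)
open import Data.Fin as Fin using (Fin; toℕ; fromℕ<; remQuot; combine)
import Data.Fin.Properties as Fin
open import Data.Product using (∃-syntax; ∃₂; _×_; _,_; proj₁; proj₂; uncurry)
open import Data.Sum using (_⊎_; inj₁; inj₂; [_,_]′)
open import Data.Empty using (⊥-elim)
open import Relation.Nullary using (¬_; ¬?; Dec; yes; no)
open import Relation.Nullary.Decidable using (False; toWitness; toWitnessFalse; _×-dec_; _→-dec_)
open import Relation.Binary.Definitions using (tri<; tri≈; tri>)
open import Relation.Binary.PropositionalEquality

coprime-∣ˡ : ∀ {m n d} → Coprime m n → d ℕ.∣ m → Coprime d n
coprime-∣ˡ m⊥n d∣m (i∣d , i∣n) = m⊥n (ℕ.∣-trans i∣d d∣m , i∣n)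

coprime-*ʳ : ∀ {m n o} → Coprime m n → Coprime m o → Coprime m (n ℕ.* o)
coprime-*ʳ m⊥n m⊥o (i∣m , i∣no) = m⊥o (i∣m , coprime-divisor (coprime-∣ˡ m⊥n i∣m) i∣no)

square-reflects-≤ : ∀ {x y} → x ℕ.* x ℕ.≤ y ℕ.* y → x ℕ.≤ y
square-reflects-≤ {x} {y} x²≤y² with ℕ.≤-<-connex x y
... | inj₁ x≤y = x≤y
... | inj₂ y<x = ⊥-elim (ℕ.<⇒≱ (ℕ.*-mono-< y<x y<x) x²≤y²)

square-reflects-< : ∀ {x y} → x ℕ.* x ℕ.< y ℕ.* y → x ℕ.< y
square-reflects-< {x} {y} x²<y² with ℕ.<-≤-connex x y
... | inj₁ x<y = x<y
... | inj₂ y≤x = ⊥-elim (ℕ.<⇒≱ x²<y² (ℕ.*-mono-≤ y≤x y≤x))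

StrictlyIncreasing : (ℕ → ℕ) → Set
StrictlyIncreasing f = ∀ k → f k ℕ.< f (suc k)

module _ {f : ℕ → ℕ} (f↑ : StrictlyIncreasing f) where

  increasing-mono-< : ∀ {i j} → i ℕ.< j → f i ℕ.< f j
  increasing-mono-< {i} {suc j} (s≤s i≤j) with ℕ.m≤n⇒m<n∨m≡n i≤j
  ... | inj₁ i<j = ℕ.<-trans (increasing-mono-< i<j) (f↑ j)
  ... | inj₂ refl = f↑ j

  increasing-reflects-< : ∀ {i j} → f i ℕ.< f j → i ℕ.< j
  increasing-reflects-< {i} {j} fi<fj with ℕ.<-cmp i j
  ... | tri< i<j _ _ = i<j
  ... | tri≈ _ refl _ = ⊥-elim (ℕ.<-irrefl refl fi<fj)
  ... | tri> _ _ j<i = ⊥-elim (ℕ.<-asym fi<fj (increasing-mono-< j<i))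

  increasing-injective : ∀ {i j} → f i ≡ f j → i ≡ j
  increasing-injective {i} {j} fi≡fj with ℕ.<-cmp i j
  ... | tri< i<j _ _ = ⊥-elim (ℕ.<-irrefl fi≡fj (increasing-mono-< i<j))
  ... | tri≈ _ i≡j _ = i≡j
  ... | tri> _ _ j<i = ⊥-elim (ℕ.<-irrefl (sym fi≡fj) (increasing-mono-< j<i))

  increasing-inflationary : ∀ k → k ℕ.≤ f k
  increasing-inflationary zero = z≤n
  increasing-inflationary (suc k) = ℕ.<-≤-trans (s≤s (increasing-inflationary k)) (f↑ k)

increasing-same-range⇒≗ : ∀ {f g} → StrictlyIncreasing f → StrictlyIncreasing g →
  (∀ k → ∃[ j ] f k ≡ g j) → (∀ j → ∃[ k ] g j ≡ f k) → ∀ k → f k ≡ g k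
increasing-same-range⇒≗ {f} {g} f↑ g↑ f⊆g g⊆f k = trans (f≡gσ k) (cong g σk≡k)
  where
  σ τ : ℕ → ℕ
  σ k = proj₁ (f⊆g k)
  τ j = proj₁ (g⊆f j)
  f≡gσ : ∀ k → f k ≡ g (σ k)
  f≡gσ k = proj₂ (f⊆g k)
  σ↑ : StrictlyIncreasing σ
  σ↑ k = increasing-reflects-< g↑ (subst₂ ℕ._<_ (f≡gσ k) (f≡gσ (suc k)) (f↑ k))
  τ↑ : StrictlyIncreasing τ
  τ↑ j = increasing-reflects-< f↑ (subst₂ ℕ._<_ (proj₂ (g⊆f j)) (proj₂ (g⊆f (suc j))) (g↑ j))
  τσk≡k : τ (σ k) ≡ k
  τσk≡k = increasing-injective f↑ (trans (sym (proj₂ (g⊆f (σ k)))) (sym (f≡gσ k)))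
  σk≡k : σ k ≡ k
  σk≡k = ℕ.≤-antisym (subst (σ k ℕ.≤_) τσk≡k (increasing-inflationary τ↑ (σ k))) (increasing-inflationary σ↑ k)

module PellEquation where

  open import Data.Nat using (_+_; _*_; _∸_; _<_; _≤_)
  open import Data.Nat.Divisibility using (_∣_; divides; ∣-trans; m∣m*n; ∣m⇒∣m*n; ∣n⇒∣m*n; ∣m+n∣m⇒∣n; ∣1⇒≡1)
  open import Data.Nat.Tactic.RingSolver using (solve-∀)

  -- Brahmagupta's identity in a subtraction-free form: multiplying by a solution (c, e) preserves x² − d z².
  module _ {d c e : ℕ} (c²≡1+de² : c * c ≡ 1 + d * (e * e)) where

    pell-norm-invariant : ∀ x z →
      (x * c + d * (z * e)) * (x * c + d * (z * e)) + d * (z * z) ≡ x * x + d * ((x * e + z * c) * (x * e + z * c))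
    pell-norm-invariant x z = begin
      (x * c + d * (z * e)) * (x * c + d * (z * e)) + d * (z * z)
        ≡⟨ expand-lhs d c e x z ⟩
      (c * c) * (x * x) + R
        ≡⟨ cong (λ u → u * (x * x) + R) c²≡1+de² ⟩
      (1 + d * (e * e)) * (x * x) + R
        ≡⟨ regroup d c e x z ⟩
      x * x + d * ((x * e) * (x * e) + 2 * (x * e * (z * c)) + (1 + d * (e * e)) * (z * z))
        ≡⟨ cong (λ u → x * x + d * ((x * e) * (x * e) + 2 * (x * e * (z * c)) + u * (z * z))) (sym c²≡1+de²) ⟩
      x * x + d * ((x * e) * (x * e) + 2 * (x * e * (z * c)) + (c * c) * (z * z))
        ≡⟨ expand-rhs d c e x z ⟩
      x * x + d * ((x * e + z * c) * (x * e + z * c)) ∎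
      where
      open ≡-Reasoning
      R = 2 * d * (c * e * (x * z)) + d * d * ((e * e) * (z * z)) + d * (z * z)
      expand-lhs : ∀ d c e x z → (x * c + d * (z * e)) * (x * c + d * (z * e)) + d * (z * z)
        ≡ (c * c) * (x * x) + (2 * d * (c * e * (x * z)) + d * d * ((e * e) * (z * z)) + d * (z * z))
      expand-lhs = solve-∀
      regroup : ∀ d c e x z →
        (1 + d * (e * e)) * (x * x) + (2 * d * (c * e * (x * z)) + d * d * ((e * e) * (z * z)) + d * (z * z))
        ≡ x * x + d * ((x * e) * (x * e) + 2 * (x * e * (z * c)) + (1 + d * (e * e)) * (z * z))
      regroup = solve-∀
      expand-rhs : ∀ d c e x z → x * x + d * ((x * e) * (x * e) + 2 * (x * e * (z * c)) + (c * c) * (z * z))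
        ≡ x * x + d * ((x * e + z * c) * (x * e + z * c))
      expand-rhs = solve-∀

    private
      swap : ∀ a b c → a + b + c ≡ a + c + b
      swap = solve-∀

    pell-step : ∀ {x z} → x * x ≡ 1 + d * (z * z) →
      (x * c + d * (z * e)) * (x * c + d * (z * e)) ≡ 1 + d * ((x * e + z * c) * (x * e + z * c))
    pell-step {x} {z} x²≡1+dz² = ℕ.+-cancelʳ-≡ (d * (z * z)) _ _ (begin
      (x * c + d * (z * e)) * (x * c + d * (z * e)) + d * (z * z) ≡⟨ pell-norm-invariant x z ⟩
      x * x + d * W                                                ≡⟨ cong (_+ d * W) x²≡1+dz² ⟩
      1 + d * (z * z) + d * W                                      ≡⟨ swap 1 (d * (z * z)) (d * W) ⟩
      1 + d * W + d * (z * z)                                      ∎)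
      where
      open ≡-Reasoning
      W = (x * e + z * c) * (x * e + z * c)

    pell-unstep : ∀ {x z} →
      (x * c + d * (z * e)) * (x * c + d * (z * e)) ≡ 1 + d * ((x * e + z * c) * (x * e + z * c)) →
      x * x ≡ 1 + d * (z * z)
    pell-unstep {x} {z} step = ℕ.+-cancelʳ-≡ (d * W) _ _ (begin
      x * x + d * W                                                ≡⟨ pell-norm-invariant x z ⟨
      (x * c + d * (z * e)) * (x * c + d * (z * e)) + d * (z * z) ≡⟨ cong (_+ d * (z * z)) step ⟩
      1 + d * W + d * (z * z)                                      ≡⟨ swap 1 (d * W) (d * (z * z)) ⟩
      1 + d * (z * z) + d * W                                      ∎)
      where
      open ≡-Reasoning
      W = (x * e + z * c) * (x * e + z * c)

  -- X k + Z k √D = (c + √D) ^ k, where c = 1 + g.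
  module PellSequence (g D : ℕ) (c²≡1+D : suc g * suc g ≡ 1 + D) where

    c : ℕ
    c = suc g

    mutual
      X : ℕ → ℕ
      X zero = 1
      X (suc k) = X k * c + D * Z k

      Z : ℕ → ℕ
      Z zero = 0
      Z (suc k) = X k + Z k * c

    pell : ∀ k → X k * X k ≡ 1 + D * (Z k * Z k)
    pell zero = cong suc (sym (ℕ.*-zeroʳ D))
    pell (suc k) =
      subst₂ (λ z x → (X k * c + D * z) * (X k * c + D * z) ≡ 1 + D * ((x + Z k * c) * (x + Z k * c)))
        (ℕ.*-identityʳ (Z k)) (ℕ.*-identityʳ (X k)) (pell-step {D} {c} {1} c²≡1+D·1² {X k} {Z k} (pell k))
      where
      c²≡1+D·1² : c * c ≡ 1 + D * (1 * 1)
      c²≡1+D·1² = trans c²≡1+D (cong (1 +_) (sym (ℕ.*-identityʳ D)))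

    addition : ∀ m n → X (m + n) ≡ X m * X n + D * (Z m * Z n) × Z (m + n) ≡ X m * Z n + Z m * X n
    addition zero n = base-X (X n) (Z n) D , base-Z (X n) (Z n)
      where
      base-X : ∀ x z D → x ≡ 1 * x + D * (0 * z)
      base-X = solve-∀
      base-Z : ∀ x z → z ≡ 1 * z + 0 * x
      base-Z = solve-∀
    addition (suc m) n =
      trans (cong₂ (λ x z → x * c + D * z) X-sum Z-sum) (step-X (X m) (Z m) (X n) (Z n) c D) ,
      trans (cong₂ (λ x z → x + z * c) X-sum Z-sum) (step-Z (X m) (Z m) (X n) (Z n) c D)
      where
      X-sum = proj₁ (addition m n)
      Z-sum = proj₂ (addition m n)
      step-X : ∀ xm zm xn zn c D → (xm * xn + D * (zm * zn)) * c + D * (xm * zn + zm * xn)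
        ≡ (xm * c + D * zm) * xn + D * ((xm + zm * c) * zn)
      step-X = solve-∀
      step-Z : ∀ xm zm xn zn c D → xm * xn + D * (zm * zn) + (xm * zn + zm * xn) * c
        ≡ (xm * c + D * zm) * zn + (xm + zm * c) * xn
      step-Z = solve-∀

    Z-double : ∀ n → Z (n + n) ≡ Z n * (2 * X n)
    Z-double n = trans (proj₂ (addition n n)) (twice (X n) (Z n))
      where
      twice : ∀ x z → x * z + z * x ≡ z * (2 * x)
      twice = solve-∀

    Z-odd-expansion : ∀ k → Z (suc (k + k)) ≡ X k * X k + (c + c) * (X k * Z k) + D * (Z k * Z k)
    Z-odd-expansion k = trans (proj₂ (addition (suc k) k)) (expand (X k) (Z k) c D)
      where
      expand : ∀ x z c D → (x * c + D * z) * z + (x + z * c) * x ≡ x * x + (c + c) * (x * z) + D * (z * z)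
      expand = solve-∀

    D≡g[2+g] : D ≡ g * (2 + g)
    D≡g[2+g] = trans (sym (ℕ.suc-injective c²≡1+D)) (expand g)
      where
      expand : ∀ g → g + g * suc g ≡ g * (2 + g)
      expand = solve-∀

    Z-odd-factorisation : ∀ k → Z (suc (k + k)) ≡ (X k + g * Z k) * (X k + (2 + g) * Z k)
    Z-odd-factorisation k = begin
      Z (suc (k + k))                                               ≡⟨ Z-odd-expansion k ⟩
      X k * X k + (c + c) * (X k * Z k) + D * (Z k * Z k)
        ≡⟨ cong (λ D → X k * X k + (c + c) * (X k * Z k) + D * (Z k * Z k)) D≡g[2+g] ⟩
      X k * X k + (c + c) * (X k * Z k) + g * (2 + g) * (Z k * Z k) ≡⟨ factor (X k) (Z k) g ⟩
      (X k + g * Z k) * (X k + (2 + g) * Z k)                       ∎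
      where
      open ≡-Reasoning
      factor : ∀ x z g → x * x + (suc g + suc g) * (x * z) + g * (2 + g) * (z * z) ≡ (x + g * z) * (x + (2 + g) * z)
      factor = solve-∀

    Z-odd-is-odd : ∀ k → ¬ (2 ∣ Z (suc (k + k)))
    Z-odd-is-odd k 2∣Z with ∣1⇒≡1 (∣m+n∣m⇒∣n (subst (2 ∣_) odd-form 2∣Z) (m∣m*n M))
      where
      M = c * (X k * Z k) + D * (Z k * Z k)
      odd-form : Z (suc (k + k)) ≡ 2 * M + 1
      odd-form = trans (Z-odd-expansion k)
                   (trans (cong (λ s → s + (c + c) * (X k * Z k) + D * (Z k * Z k)) (pell k)) (regroup (X k * Z k) (Z k * Z k) c D))
        where
        regroup : ∀ xz zz c D → 1 + D * zz + (c + c) * xz + D * zz ≡ 2 * (c * xz + D * zz) + 1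
        regroup = solve-∀
    ... | ()

    X-Z-coprime : ∀ k → Coprime (X k) (Z k)
    X-Z-coprime k {i} (i∣X , i∣Z) =
      ∣1⇒≡1 (∣m+n∣m⇒∣n (subst (i ∣_) (trans (pell k) (ℕ.+-comm 1 _)) (∣m⇒∣m*n (X k) i∣X))
                       (∣n⇒∣m*n D (∣m⇒∣m*n (Z k) i∣Z)))

    X-positive : ∀ k → 0 < X k
    X-positive k = ℕ.n≢0⇒n>0 λ X≡0 → ℕ.1+n≢0 (trans (sym (pell k)) (cong (λ x → x * x) X≡0))

    Z-increasing : ∀ k → Z k < Z (suc k)
    Z-increasing k = ℕ.<-≤-trans (ℕ.m<n+m (Z k) (X-positive k)) (ℕ.+-monoʳ-≤ (X k) (ℕ.m≤m*n (Z k) c))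

    Z-suc-positive : ∀ k → 0 < Z (suc k)
    Z-suc-positive k = ℕ.<-≤-trans (X-positive k) (ℕ.m≤m+n (X k) (Z k * c))

    Z-odd-coprime-2 : ∀ k → Coprime (Z (suc (k + k))) 2
    Z-odd-coprime-2 k {i} (i∣Z , i∣2) with prime⇒irreducible prime[2] i∣2
    ... | inj₁ i≡1 = i≡1
    ... | inj₂ refl = ⊥-elim (Z-odd-is-odd k i∣Z)

    first-odd-factor-∣ : ∀ k → X k + g * Z k ∣ Z (suc (k + k))
    first-odd-factor-∣ k =
      divides (X k + (2 + g) * Z k) (trans (Z-odd-factorisation k) (ℕ.*-comm (X k + g * Z k) (X k + (2 + g) * Z k)))

    second-odd-factor-∣ : ∀ k → X k + (2 + g) * Z k ∣ Z (suc (k + k))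
    second-odd-factor-∣ k = divides (X k + g * Z k) (Z-odd-factorisation k)

    odd-factors-coprime : ∀ k → Coprime (X k + g * Z k) (X k + (2 + g) * Z k)
    odd-factors-coprime k {i} (i∣A , i∣B) = Z-odd-coprime-2 k (∣-trans i∣A (first-odd-factor-∣ k) , i∣2)
      where
      i⊥Z : Coprime i (Z k)
      i⊥Z {j} (j∣i , j∣Z) =
        X-Z-coprime k (∣m+n∣m⇒∣n (subst (j ∣_) (ℕ.+-comm (X k) (g * Z k)) (∣-trans j∣i i∣A)) (∣n⇒∣m*n g j∣Z) , j∣Z)
      i∣2 : i ∣ 2
      i∣2 = coprime-divisor i⊥Z (∣m+n∣m⇒∣n (subst (i ∣_) (B≡A+2Z (X k) (Z k) g) i∣B) i∣A)
        where
        B≡A+2Z : ∀ x z g → x + (2 + g) * z ≡ x + g * z + z * 2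
        B≡A+2Z = solve-∀

    odd-factors-coprime-to-cofactor : ∀ k {C} → Coprime (Z (suc (k + k))) C →
      Coprime (X k + g * Z k) ((X k + (2 + g) * Z k) * C) × Coprime (X k + (2 + g) * Z k) ((X k + g * Z k) * C)
    odd-factors-coprime-to-cofactor k Z⊥C =
      coprime-*ʳ (odd-factors-coprime k) (coprime-∣ˡ Z⊥C (first-odd-factor-∣ k)) ,
      coprime-*ʳ (Coprime-sym (odd-factors-coprime k)) (coprime-∣ˡ Z⊥C (second-odd-factor-∣ k))

    Z-odd-multiple : ∀ k a → ∃[ C ] (Z (2 ^ a * suc (k + k)) ≡ Z (suc (k + k)) * C × Coprime (Z (suc (k + k))) C)
    Z-odd-multiple k zero =
      1 , trans (cong Z (ℕ.*-identityˡ (suc (k + k)))) (sym (ℕ.*-identityʳ (Z (suc (k + k))))) , λ (_ , i∣1) → ∣1⇒≡1 i∣1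
    Z-odd-multiple k (suc a) =
      let C , Z[N]≡Z[b]C , Z[b]⊥C = Z-odd-multiple k a
          N = 2 ^ a * suc (k + k)
      in C * (2 * X N) ,
         (begin
           Z (2 ^ suc a * suc (k + k))   ≡⟨ cong Z (double (2 ^ a) (suc (k + k))) ⟩
           Z (N + N)                     ≡⟨ Z-double N ⟩
           Z N * (2 * X N)               ≡⟨ cong (_* (2 * X N)) Z[N]≡Z[b]C ⟩
           Z (suc (k + k)) * C * (2 * X N) ≡⟨ ℕ.*-assoc (Z (suc (k + k))) C (2 * X N) ⟩
           Z (suc (k + k)) * (C * (2 * X N)) ∎) ,
         coprime-*ʳ Z[b]⊥C (coprime-*ʳ (Z-odd-coprime-2 k) λ (i∣Z[b] , i∣X) →
           X-Z-coprime N (i∣X , subst (_ ∣_) (sym Z[N]≡Z[b]C) (∣m⇒∣m*n C i∣Z[b])))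
      where
      open ≡-Reasoning
      double : ∀ p b → 2 * p * b ≡ p * b + p * b
      double = solve-∀

  -- A solution (a, b) with b ≥ e is the product of (c, e) with the smaller solution (a c − d e b, b c − a e).
  module PellDescent (d g e : ℕ) (c²≡1+de² : suc g * suc g ≡ 1 + d * (e * e)) (0<e : 0 < e)
                     (fundamental : ∀ a b → 0 < b → b < e → a * a ≢ 1 + d * (b * b)) where

    open PellSequence g (d * (e * e)) c²≡1+de² public

    private
      interchange : ∀ x y → (x * x) * (y * y) ≡ x * y * (x * y)
      interchange = solve-∀
      spread : ∀ b d e → (1 + d * (b * b)) * (e * e) ≡ e * e + (b * b) * (d * (e * e))
      spread = solve-∀

    g²≤de² : g * g ≤ d * (e * e)
    g²≤de² = ℕ.≤-trans (ℕ.*-monoʳ-≤ g (ℕ.n≤1+n g))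
               (ℕ.≤-trans (ℕ.m≤n+m (g * suc g) g) (ℕ.≤-reflexive (ℕ.suc-injective c²≡1+de²)))

    module _ {a b : ℕ} (a²≡1+db² : a * a ≡ 1 + d * (b * b)) where

      bde≤ac : b * (d * e) ≤ a * c
      bde≤ac = square-reflects-≤ (begin
        b * (d * e) * (b * (d * e))           ≡⟨ regroup b d e ⟩
        d * (b * b) * (d * (e * e))           ≤⟨ ℕ.*-mono-≤ (ℕ.n≤1+n (d * (b * b))) (ℕ.n≤1+n (d * (e * e))) ⟩
        (1 + d * (b * b)) * (1 + d * (e * e)) ≡⟨ cong₂ _*_ (sym a²≡1+db²) (sym c²≡1+de²) ⟩
        (a * a) * (c * c)                     ≡⟨ interchange a c ⟩
        a * c * (a * c)                       ∎)
        where
        open ℕ.≤-Reasoning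
        regroup : ∀ b d e → b * (d * e) * (b * (d * e)) ≡ d * (b * b) * (d * (e * e))
        regroup = solve-∀

      ae≤bc : e ≤ b → a * e ≤ b * c
      ae≤bc e≤b = square-reflects-≤ (begin
        a * e * (a * e)                    ≡⟨ interchange a e ⟨
        (a * a) * (e * e)                  ≡⟨ cong (_* (e * e)) a²≡1+db² ⟩
        (1 + d * (b * b)) * (e * e)        ≡⟨ spread b d e ⟩
        e * e + (b * b) * (d * (e * e))    ≤⟨ ℕ.+-monoˡ-≤ _ (ℕ.*-mono-≤ e≤b e≤b) ⟩
        b * b + (b * b) * (d * (e * e))    ≡⟨ factor b d e ⟩
        (b * b) * (1 + d * (e * e))        ≡⟨ cong ((b * b) *_) (sym c²≡1+de²) ⟩
        (b * b) * (c * c)                  ≡⟨ interchange b c ⟩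
        b * c * (b * c)                    ∎)
        where
        open ℕ.≤-Reasoning
        factor : ∀ b d e → b * b + (b * b) * (d * (e * e)) ≡ (b * b) * (1 + d * (e * e))
        factor = solve-∀

      bg<ae : b * g < a * e
      bg<ae = square-reflects-< (begin-strict
        b * g * (b * g)                    ≡⟨ interchange b g ⟨
        (b * b) * (g * g)                  ≤⟨ ℕ.*-monoʳ-≤ (b * b) g²≤de² ⟩
        (b * b) * (d * (e * e))            <⟨ ℕ.m<n+m _ (ℕ.*-mono-< 0<e 0<e) ⟩
        e * e + (b * b) * (d * (e * e))    ≡⟨ spread b d e ⟨
        (1 + d * (b * b)) * (e * e)        ≡⟨ cong (_* (e * e)) a²≡1+db² ⟨
        (a * a) * (e * e)                  ≡⟨ interchange a e ⟩
        a * e * (a * e)                    ∎)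
        where open ℕ.≤-Reasoning

    module _ {a a′ b b′ : ℕ} (E₁ : a′ + b * (d * e) ≡ a * c) (E₂ : b′ + a * e ≡ b * c) where

      undo-first : a′ * c + d * (b′ * e) ≡ a
      undo-first = ℕ.+-cancelʳ-≡ K _ _ (begin
        a′ * c + d * (b′ * e) + K                       ≡⟨ collect a a′ b b′ c d e ⟩
        (a′ + b * (d * e)) * c + (b′ + a * e) * (d * e) ≡⟨ cong₂ (λ u v → u * c + v * (d * e)) E₁ E₂ ⟩
        a * c * c + b * c * (d * e)
          ≡⟨ cong (_+ b * c * (d * e)) (trans (ℕ.*-assoc a c c) (cong (a *_) c²≡1+de²)) ⟩
        a * (1 + d * (e * e)) + b * c * (d * e)         ≡⟨ distribute a b c d e ⟩
        a + K                                           ∎)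
        where
        open ≡-Reasoning
        K = b * (d * e) * c + a * e * (d * e)
        collect : ∀ a a′ b b′ c d e → a′ * c + d * (b′ * e) + (b * (d * e) * c + a * e * (d * e))
          ≡ (a′ + b * (d * e)) * c + (b′ + a * e) * (d * e)
        collect = solve-∀
        distribute : ∀ a b c d e → a * (1 + d * (e * e)) + b * c * (d * e) ≡ a + (b * (d * e) * c + a * e * (d * e))
        distribute = solve-∀

      undo-second : a′ * e + b′ * c ≡ b
      undo-second = ℕ.+-cancelʳ-≡ K _ _ (begin
        a′ * e + b′ * c + K                        ≡⟨ collect a a′ b b′ c d e ⟩
        (a′ + b * (d * e)) * e + (b′ + a * e) * c  ≡⟨ cong₂ (λ u v → u * e + v * c) E₁ E₂ ⟩
        a * c * e + b * c * c                      ≡⟨ cong (a * c * e +_) (trans (ℕ.*-assoc b c c) (cong (b *_) c²≡1+de²)) ⟩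
        a * c * e + b * (1 + d * (e * e))          ≡⟨ distribute a b c d e ⟩
        b + K                                      ∎)
        where
        open ≡-Reasoning
        K = b * (d * e) * e + a * e * c
        collect : ∀ a a′ b b′ c d e → a′ * e + b′ * c + (b * (d * e) * e + a * e * c)
          ≡ (a′ + b * (d * e)) * e + (b′ + a * e) * c
        collect = solve-∀
        distribute : ∀ a b c d e → a * c * e + b * (1 + d * (e * e)) ≡ b + (b * (d * e) * e + a * e * c)
        distribute = solve-∀

    solution-index : ∀ a b → a * a ≡ 1 + d * (b * b) → ∃[ j ] (a ≡ X j × b ≡ e * Z j)
    solution-index a b = go b (<-wellFounded b) a
      where
      go : ∀ b → Acc _<_ b → ∀ a → a * a ≡ 1 + d * (b * b) → ∃[ j ] (a ≡ X j × b ≡ e * Z j)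
      go zero _ a a²≡1+d0 = 0 , ℕ.m*n≡1⇒m≡1 a a (trans a²≡1+d0 (cong suc (ℕ.*-zeroʳ d))) , sym (ℕ.*-zeroʳ e)
      go b@(suc _) (acc smaller) a a²≡1+db² with b ℕ.<? e
      ... | yes b<e = ⊥-elim (fundamental a b (s≤s z≤n) b<e a²≡1+db²)
      ... | no b≮e =
        let j , a′≡X , b′≡eZ = go b′ (smaller b′<b) a′ (pell-unstep {d} {c} {e} c²≡1+de² {a′} {b′} a′²≡…)
        in suc j , a≡X[1+j] {j} a′≡X b′≡eZ , b≡eZ[1+j] {j} a′≡X b′≡eZ
        where
        a′ = a * c ∸ b * (d * e)
        b′ = b * c ∸ a * e
        E₁ : a′ + b * (d * e) ≡ a * c
        E₁ = ℕ.m∸n+n≡m (bde≤ac {a} {b} a²≡1+db²)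
        E₂ : b′ + a * e ≡ b * c
        E₂ = ℕ.m∸n+n≡m (ae≤bc {a} {b} a²≡1+db² (ℕ.≮⇒≥ b≮e))
        a′²≡… : (a′ * c + d * (b′ * e)) * (a′ * c + d * (b′ * e)) ≡ 1 + d * ((a′ * e + b′ * c) * (a′ * e + b′ * c))
        a′²≡… = subst₂ (λ u v → u * u ≡ 1 + d * (v * v))
                  (sym (undo-first {a} {a′} {b} {b′} E₁ E₂)) (sym (undo-second {a} {a′} {b} {b′} E₁ E₂)) a²≡1+db²
        b′<b : b′ < b
        b′<b = ℕ.+-cancelʳ-< (a * e) b′ b (begin-strict
          b′ + a * e   ≡⟨ trans E₂ (ℕ.*-suc b g) ⟩
          b + b * g    <⟨ ℕ.+-monoʳ-< b (bg<ae {a} {b} a²≡1+db²) ⟩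
          b + a * e    ∎)
          where open ℕ.≤-Reasoning
        a≡X[1+j] : ∀ {j} → a′ ≡ X j → b′ ≡ e * Z j → a ≡ X (suc j)
        a≡X[1+j] {j} a′≡X b′≡eZ = trans (sym (undo-first {a} {a′} {b} {b′} E₁ E₂))
          (trans (cong₂ (λ x y → x * c + d * (y * e)) a′≡X b′≡eZ) (regroup (X j) (Z j) c d e))
          where
          regroup : ∀ x z c d e → x * c + d * (e * z * e) ≡ x * c + d * (e * e) * z
          regroup = solve-∀
        b≡eZ[1+j] : ∀ {j} → a′ ≡ X j → b′ ≡ e * Z j → b ≡ e * Z (suc j)
        b≡eZ[1+j] {j} a′≡X b′≡eZ = trans (sym (undo-second {a} {a′} {b} {b′} E₁ E₂))
          (trans (cong₂ (λ x y → x * e + y * c) a′≡X b′≡eZ) (regroup (X j) (Z j) c e))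
          where
          regroup : ∀ x z c e → x * e + e * z * c ≡ e * (x + z * c)
          regroup = solve-∀

    solution : ∀ j → X j * X j ≡ 1 + d * ((e * Z j) * (e * Z j))
    solution j = trans (pell j) (cong (1 +_) (regroup d e (Z j)))
      where
      regroup : ∀ d e z → d * (e * e) * (z * z) ≡ d * ((e * z) * (e * z))
      regroup = solve-∀

    solution-increasing : StrictlyIncreasing (λ j → e * Z j)
    solution-increasing j = ℕ.*-monoʳ-< e {{ℕ.>-nonZero 0<e}} (Z-increasing j)

    enumeration-unique : ∀ (x y : ℕ → ℕ) → (∀ k → x k * x k ≡ 1 + d * (y k * y k)) → StrictlyIncreasing y →
      (∀ a b → a * a ≡ 1 + d * (b * b) → ∃[ k ] (x k ≡ a × y k ≡ b)) → ∀ k → y k ≡ e * Z k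
    enumeration-unique x y x²≡1+dy² y↑ complete = increasing-same-range⇒≗ y↑ solution-increasing
      (λ k → let j , _ , yk≡eZj = solution-index (x k) (y k) (x²≡1+dy² k) in j , yk≡eZj)
      (λ j → let k , _ , yk≡eZj = complete (X j) (e * Z j) (solution j) in k , sym yk≡eZj)

open PellEquation

open import Data.Nat.Tactic.RingSolver using () renaming (solve-∀ to ℕ-solve-∀)
open import Data.Integer using (ℤ; _+_; _-_; _*_; _>_; +_; -_; -[1+_]; +<+; ∣_∣)
import Data.Integer.Properties as ℤ
open import Data.Integer.Divisibility using (_∣_)
open import Data.Integer.Divisibility.Signed
  using (divides; ∣ᵤ⇒∣; ∣⇒∣ᵤ; ∣-refl; ∣m+n∣n⇒∣m; ∣m+n∣m⇒∣n; ∣m∣n⇒∣m+n; ∣n⇒∣m*n; ∣m⇒∣m*n)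
  renaming (_∣_ to _∣ₛ_; _∣?_ to _∣ₛ?_)
open import Data.Integer.DivMod using (_%ℕ_; _/ℕ_; n%ℕd<d; a≡a%ℕn+[a/ℕn]*n)
open import Data.Integer.Tactic.RingSolver using (solve-∀)

Represented : ℤ → Set
Represented m = ∃[ a ] ∃[ b ] m ≡ Q a b

-- The ring solver does not unfold Q, so each identity below is proved in expanded form.

Q-scale : ∀ x y k → Q (x * k) (y * k) ≡ k * (k * Q x y)
Q-scale = expanded
  where
  expanded : ∀ x y k → (x * k) * (x * k) + (x * k) * (y * k) + + 5 * ((y * k) * (y * k)) ≡ k * (k * (x * x + x * y + + 5 * (y * y)))
  expanded = solve-∀

Q-mul : ∀ a b c d → Q a b * Q c d ≡ Q (a * c - + 5 * (b * d)) (a * d + b * c + b * d)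
Q-mul = expanded
  where
  expanded : ∀ a b c d → (a * a + a * b + + 5 * (b * b)) * (c * c + c * d + + 5 * (d * d))
    ≡ (a * c - + 5 * (b * d)) * (a * c - + 5 * (b * d)) + (a * c - + 5 * (b * d)) * (a * d + b * c + b * d)
      + + 5 * ((a * d + b * c + b * d) * (a * d + b * c + b * d))
  expanded = solve-∀

Q-mul′ : ∀ a b c d → Q a b * Q c d ≡ Q (a * c + b * c + + 5 * (b * d)) (a * d - b * c)
Q-mul′ = expanded
  where
  expanded : ∀ a b c d → (a * a + a * b + + 5 * (b * b)) * (c * c + c * d + + 5 * (d * d))
    ≡ (a * c + b * c + + 5 * (b * d)) * (a * c + b * c + + 5 * (b * d)) + (a * c + b * c + + 5 * (b * d)) * (a * d - b * c)
      + + 5 * ((a * d - b * c) * (a * d - b * c))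
  expanded = solve-∀

Q-cross : ∀ a b c d → d * d * Q a b ≡ b * b * Q c d + (a * d - b * c) * (a * d + b * c + b * d)
Q-cross = expanded
  where
  expanded : ∀ a b c d → d * d * (a * a + a * b + + 5 * (b * b))
    ≡ b * b * (c * c + c * d + + 5 * (d * d)) + (a * d - b * c) * (a * d + b * c + b * d)
  expanded = solve-∀

Q-split-square : ∀ c d → Q c d ≡ c * c + d * (c + + 5 * d)
Q-split-square = expanded
  where
  expanded : ∀ c d → c * c + c * d + + 5 * (d * d) ≡ c * c + d * (c + + 5 * d)
  expanded = solve-∀

Q-split-5 : ∀ u v → Q u v ≡ u * (u + v) + + 5 * (v * v)
Q-split-5 = expanded
  where
  expanded : ∀ u v → u * u + u * v + + 5 * (v * v) ≡ u * (u + v) + + 5 * (v * v)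
  expanded = solve-∀

Q-5∣first : ∀ a v → Q (a * + 5) v ≡ + 5 * Q (a + v) (- a)
Q-5∣first = expanded
  where
  expanded : ∀ a v → (a * + 5) * (a * + 5) + (a * + 5) * v + + 5 * (v * v)
    ≡ + 5 * ((a + v) * (a + v) + (a + v) * (- a) + + 5 * ((- a) * (- a)))
  expanded = solve-∀

Q-5∣sum : ∀ b v → Q (b * + 5 - v) v ≡ + 5 * Q (- v) b
Q-5∣sum = expanded
  where
  expanded : ∀ b v → (b * + 5 - v) * (b * + 5 - v) + (b * + 5 - v) * v + + 5 * (v * v)
    ≡ + 5 * ((- v) * (- v) + (- v) * b + + 5 * (b * b))
  expanded = solve-∀

4Q≡sum-of-squares : ∀ u v → + 4 * Q u v ≡ (+ 2 * u + v) * (+ 2 * u + v) + + 19 * (v * v)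
4Q≡sum-of-squares = expanded
  where
  expanded : ∀ u v → + 4 * (u * u + u * v + + 5 * (v * v)) ≡ (+ 2 * u + v) * (+ 2 * u + v) + + 19 * (v * v)
  expanded = solve-∀

Q-shift : ∀ r r′ q q′ k → ∃[ K ] Q (r + q * k) (r′ + q′ * k) ≡ Q r r′ + K * k
Q-shift r r′ q q′ k = K r r′ q q′ k , expanded r r′ q q′ k
  where
  K : ℤ → ℤ → ℤ → ℤ → ℤ → ℤ
  K r r′ q q′ k = + 2 * r * q + q * q * k + r * q′ + q * r′ + q * q′ * k + + 10 * r′ * q′ + + 5 * q′ * q′ * k
  expanded : ∀ r r′ q q′ k →
    (r + q * k) * (r + q * k) + (r + q * k) * (r′ + q′ * k) + + 5 * ((r′ + q′ * k) * (r′ + q′ * k))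
    ≡ (r * r + r * r′ + + 5 * (r′ * r′))
      + (+ 2 * r * q + q * q * k + r * q′ + q * r′ + q * q′ * k + + 10 * r′ * q′ + + 5 * q′ * q′ * k) * k
  expanded = solve-∀

euclidsLemmaℤ : ∀ {p} → Prime p → ∀ x y → + p ∣ₛ x * y → + p ∣ₛ x ⊎ + p ∣ₛ y
euclidsLemmaℤ {p} pr x y p∣xy with euclidsLemma ∣ x ∣ ∣ y ∣ pr (subst (p ℕ.∣_) (ℤ.abs-* x y) (∣⇒∣ᵤ p∣xy))
... | inj₁ p∣x = inj₁ (∣ᵤ⇒∣ p∣x)
... | inj₂ p∣y = inj₂ (∣ᵤ⇒∣ p∣y)

prime∣square⇒∣ : ∀ {p} → Prime p → ∀ x → + p ∣ₛ x * x → + p ∣ₛ x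
prime∣square⇒∣ pr x p∣x² = [ (λ h → h) , (λ h → h) ]′ (euclidsLemmaℤ pr x x p∣x²)

module _ (n : ℕ) .{{_ : ℕ.NonZero n}} where

  ≡-residue : ∀ x → x ≡ + (x %ℕ n) + (x /ℕ n) * + n
  ≡-residue x = a≡a%ℕn+[a/ℕn]*n x n

  residue≡0⇒∣ : ∀ x → x %ℕ n ≡ 0 → + n ∣ₛ x
  residue≡0⇒∣ x eq = divides (x /ℕ n)
    (trans (≡-residue x) (trans (cong (λ r → + r + (x /ℕ n) * + n) eq) (ℤ.+-identityˡ _)))

  equal-residues⇒∣- : ∀ x y → x %ℕ n ≡ y %ℕ n → + n ∣ₛ x - y
  equal-residues⇒∣- x y eq = divides (x /ℕ n - y /ℕ n) (begin
    x - y                                                    ≡⟨ cong₂ _-_ (≡-residue x) (≡-residue y) ⟩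
    (+ (x %ℕ n) + x /ℕ n * + n) - (+ (y %ℕ n) + y /ℕ n * + n)
      ≡⟨ cong (λ r → (+ (x %ℕ n) + x /ℕ n * + n) - (+ r + y /ℕ n * + n)) (sym eq) ⟩
    (+ (x %ℕ n) + x /ℕ n * + n) - (+ (x %ℕ n) + y /ℕ n * + n) ≡⟨ cancel (+ (x %ℕ n)) (x /ℕ n) (y /ℕ n) (+ n) ⟩
    (x /ℕ n - y /ℕ n) * + n                                  ∎)
    where
    open ≡-Reasoning
    cancel : ∀ r q q′ k → (r + q * k) - (r + q′ * k) ≡ (q - q′) * k
    cancel = solve-∀

  Q-anisotropic-mod : (∀ r r′ → r ℕ.< n → r′ ℕ.< n → + n ∣ₛ Q (+ r) (+ r′) → r ≡ 0 × r′ ≡ 0) →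
                      ∀ x y → + n ∣ₛ Q x y → + n ∣ₛ x × + n ∣ₛ y
  Q-anisotropic-mod anisotropic x y n∣Q
    with anisotropic (x %ℕ n) (y %ℕ n) (n%ℕd<d x n) (n%ℕd<d y n) n∣Q-residues
    where
    n∣Q-residues : + n ∣ₛ Q (+ (x %ℕ n)) (+ (y %ℕ n))
    n∣Q-residues with Q-shift (+ (x %ℕ n)) (+ (y %ℕ n)) (x /ℕ n) (y /ℕ n) (+ n)
    ... | K , eq =
      ∣m+n∣n⇒∣m (subst (+ n ∣ₛ_) (trans (cong₂ Q (≡-residue x) (≡-residue y)) eq) n∣Q) (∣n⇒∣m*n K ∣-refl)
  ... | x%n≡0 , y%n≡0 = residue≡0⇒∣ x x%n≡0 , residue≡0⇒∣ y y%n≡0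

∤-by-computation : ∀ {n m} {n∤m : False (n ℕ.∣? m)} → ¬ (+ n ∣ₛ + m)
∤-by-computation {n∤m = n∤m} n∣m = toWitnessFalse n∤m (∣⇒∣ᵤ n∣m)

Q-anisotropic-mod-2 : ∀ x y → + 2 ∣ₛ Q x y → + 2 ∣ₛ x × + 2 ∣ₛ y
Q-anisotropic-mod-2 = Q-anisotropic-mod 2 residues
  where
  residues : ∀ r r′ → r ℕ.< 2 → r′ ℕ.< 2 → + 2 ∣ₛ Q (+ r) (+ r′) → r ≡ 0 × r′ ≡ 0
  residues 0 0 _ _ _ = refl , refl
  residues 0 1 _ _ 2∣5 = ⊥-elim (∤-by-computation 2∣5)
  residues 1 0 _ _ 2∣1 = ⊥-elim (∤-by-computation 2∣1)
  residues 1 1 _ _ 2∣7 = ⊥-elim (∤-by-computation 2∣7)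
  residues (suc (suc _)) _ (s≤s (s≤s ())) _ _
  residues _ (suc (suc _)) _ (s≤s (s≤s ())) _

Q-anisotropic-mod-3 : ∀ x y → + 3 ∣ₛ Q x y → + 3 ∣ₛ x × + 3 ∣ₛ y
Q-anisotropic-mod-3 = Q-anisotropic-mod 3 residues
  where
  residues : ∀ r r′ → r ℕ.< 3 → r′ ℕ.< 3 → + 3 ∣ₛ Q (+ r) (+ r′) → r ≡ 0 × r′ ≡ 0
  residues 0 0 _ _ _ = refl , refl
  residues 0 1 _ _ 3∣5 = ⊥-elim (∤-by-computation 3∣5)
  residues 0 2 _ _ 3∣20 = ⊥-elim (∤-by-computation 3∣20)
  residues 1 0 _ _ 3∣1 = ⊥-elim (∤-by-computation 3∣1)
  residues 1 1 _ _ 3∣7 = ⊥-elim (∤-by-computation 3∣7)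
  residues 1 2 _ _ 3∣23 = ⊥-elim (∤-by-computation 3∣23)
  residues 2 0 _ _ 3∣4 = ⊥-elim (∤-by-computation 3∣4)
  residues 2 1 _ _ 3∣11 = ⊥-elim (∤-by-computation 3∣11)
  residues 2 2 _ _ 3∣28 = ⊥-elim (∤-by-computation 3∣28)
  residues (suc (suc (suc _))) _ (s≤s (s≤s (s≤s ()))) _ _
  residues _ (suc (suc (suc _))) _ (s≤s (s≤s (s≤s ()))) _

∣m-n∣≤ : ∀ {a b m} → a ℕ.≤ m → b ℕ.≤ m → ∣ + a - + b ∣ ℕ.≤ m
∣m-n∣≤ {a} {b} a≤m b≤m =
  subst (ℕ._≤ _) (cong ∣_∣ (sym (ℤ.m-n≡m⊖n a b))) (ℕ.≤-trans (ℤ.∣m⊝n∣≤m⊔n a b) (ℕ.⊔-lub a≤m b≤m))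

-- Pigeonhole: two of the (m + 1)² values a t − b w with 0 ≤ a, b ≤ m agree modulo p.
thue : ∀ p m .{{_ : ℕ.NonZero p}} → p ℕ.< suc m ℕ.* suc m → ∀ w t →
       ∃[ u ] ∃[ v ] (¬ (u ≡ + 0 × v ≡ + 0) × ∣ u ∣ ℕ.≤ m × ∣ v ∣ ℕ.≤ m × + p ∣ₛ u * t - v * w)
thue p m p<[1+m]² w t = from-collision (Fin.pigeonhole p<[1+m]² residue)
  where
  a b : Fin (suc m ℕ.* suc m) → ℕ
  a i = toℕ (proj₁ (remQuot {suc m} (suc m) i))
  b i = toℕ (proj₂ (remQuot {suc m} (suc m) i))
  value : Fin (suc m ℕ.* suc m) → ℤ
  value i = + a i * t - + b i * w
  residue : Fin (suc m ℕ.* suc m) → Fin p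
  residue i = fromℕ< (n%ℕd<d (value i) p)
  a≤m : ∀ i → a i ℕ.≤ m
  a≤m i = Fin.toℕ≤pred[n] (proj₁ (remQuot {suc m} (suc m) i))
  b≤m : ∀ i → b i ℕ.≤ m
  b≤m i = Fin.toℕ≤pred[n] (proj₂ (remQuot {suc m} (suc m) i))
  from-collision : ∃₂ (λ i j → i Fin.< j × residue i ≡ residue j) →
    ∃[ u ] ∃[ v ] (¬ (u ≡ + 0 × v ≡ + 0) × ∣ u ∣ ℕ.≤ m × ∣ v ∣ ℕ.≤ m × + p ∣ₛ u * t - v * w)
  from-collision (i , j , i<j , same-residue) =
    + a i - + a j , + b i - + b j , distinct , ∣m-n∣≤ (a≤m i) (a≤m j) , ∣m-n∣≤ (b≤m i) (b≤m j) , divisible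
    where
    distinct : ¬ (+ a i - + a j ≡ + 0 × + b i - + b j ≡ + 0)
    distinct (a≡ , b≡) = Fin.<-irrefl i≡j i<j
      where
      same-pair : remQuot {suc m} (suc m) i ≡ remQuot {suc m} (suc m) j
      same-pair = cong₂ _,_ (Fin.toℕ-injective (ℤ.+-injective (ℤ.i-j≡0⇒i≡j _ _ a≡)))
                            (Fin.toℕ-injective (ℤ.+-injective (ℤ.i-j≡0⇒i≡j _ _ b≡)))
      i≡j : i ≡ j
      i≡j = trans (sym (Fin.combine-remQuot {suc m} (suc m) i))
                  (trans (cong (uncurry combine) same-pair) (Fin.combine-remQuot {suc m} (suc m) j))
    divisible : + p ∣ₛ (+ a i - + a j) * t - (+ b i - + b j) * w
    divisible = subst (+ p ∣ₛ_) (regroup (+ a i) (+ a j) (+ b i) (+ b j) t w)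
      (equal-residues⇒∣- p (value i) (value j)
        (trans (sym (Fin.toℕ-fromℕ< _)) (trans (cong toℕ same-residue) (Fin.toℕ-fromℕ< _))))
      where
      regroup : ∀ x x′ y y′ t w → (x * t - y * w) - (x′ * t - y′ * w) ≡ (x - x′) * t - (y - y′) * w
      regroup = solve-∀

i*i≡∣i∣*∣i∣ : ∀ x → x * x ≡ + (∣ x ∣ ℕ.* ∣ x ∣)
i*i≡∣i∣*∣i∣ (+ n) = sym (ℤ.pos-* n n)
i*i≡∣i∣*∣i∣ -[1+ n ] = refl

sqrt-bracket : ∀ p → ∃[ m ] (m ℕ.* m ℕ.≤ p × p ℕ.< suc m ℕ.* suc m)
sqrt-bracket zero = 0 , z≤n , s≤s z≤n
sqrt-bracket (suc p) with sqrt-bracket p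
... | m , m²≤p , p<[1+m]² with suc m ℕ.* suc m ℕ.≤? suc p
...   | yes [1+m]²≤1+p = suc m , [1+m]²≤1+p , ℕ.≤-<-trans p<[1+m]² (ℕ.*-mono-< (ℕ.n<1+n (suc m)) (ℕ.n<1+n (suc m)))
...   | no [1+m]²≰1+p = m , ℕ.m≤n⇒m≤1+n m²≤p , ℕ.≰⇒> [1+m]²≰1+p

prime≢square : ∀ {p} → Prime p → ∀ m → m ℕ.* m ≢ p
prime≢square pr m m²≡p with prime⇒irreducible pr (ℕ.divides m (sym m²≡p))
... | inj₁ refl = ¬prime[1] (subst Prime (sym m²≡p) pr)
prime≢square pr (suc (suc k)) m²≡p | inj₂ refl = ℕ.<-irrefl (sym m²≡p) (ℕ.m<m*n (suc (suc k)) (suc (suc k)) (s≤s (s≤s z≤n)))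
prime≢square pr 0 m²≡p | inj₂ refl = ¬prime[0] pr

norm : ℤ → ℤ → ℕ
norm u v = ∣ + 2 * u + v ∣ ℕ.* ∣ + 2 * u + v ∣ ℕ.+ 19 ℕ.* (∣ v ∣ ℕ.* ∣ v ∣)

4Q≡norm : ∀ u v → + 4 * Q u v ≡ + norm u v
4Q≡norm u v = begin
  + 4 * Q u v                                  ≡⟨ 4Q≡sum-of-squares u v ⟩
  s * s + + 19 * (v * v)                       ≡⟨ cong₂ (λ a b → a + + 19 * b) (i*i≡∣i∣*∣i∣ s) (i*i≡∣i∣*∣i∣ v) ⟩
  + (∣ s ∣ ℕ.* ∣ s ∣) + + 19 * + (∣ v ∣ ℕ.* ∣ v ∣) ≡⟨ cong (λ z → + (∣ s ∣ ℕ.* ∣ s ∣) + z) (sym (ℤ.pos-* 19 (∣ v ∣ ℕ.* ∣ v ∣))) ⟩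
  + (∣ s ∣ ℕ.* ∣ s ∣) + + (19 ℕ.* (∣ v ∣ ℕ.* ∣ v ∣)) ≡⟨ sym (ℤ.pos-+ (∣ s ∣ ℕ.* ∣ s ∣) (19 ℕ.* (∣ v ∣ ℕ.* ∣ v ∣))) ⟩
  + norm u v                                   ∎
  where
  open ≡-Reasoning
  s = + 2 * u + v

norm≤ : ∀ {u v m} → ∣ u ∣ ℕ.≤ m → ∣ v ∣ ℕ.≤ m → norm u v ℕ.≤ 28 ℕ.* (m ℕ.* m)
norm≤ {u} {v} {m} ∣u∣≤m ∣v∣≤m = begin
  norm u v
    ≤⟨ ℕ.+-mono-≤ (ℕ.*-mono-≤ ∣2u+v∣≤3m ∣2u+v∣≤3m) (ℕ.*-monoʳ-≤ 19 (ℕ.*-mono-≤ ∣v∣≤m ∣v∣≤m)) ⟩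
  (2 ℕ.* m ℕ.+ m) ℕ.* (2 ℕ.* m ℕ.+ m) ℕ.+ 19 ℕ.* (m ℕ.* m)
    ≡⟨ 9m²+19m²≡28m² m ⟩
  28 ℕ.* (m ℕ.* m) ∎
  where
  open ℕ.≤-Reasoning
  9m²+19m²≡28m² : ∀ m → (2 ℕ.* m ℕ.+ m) ℕ.* (2 ℕ.* m ℕ.+ m) ℕ.+ 19 ℕ.* (m ℕ.* m) ≡ 28 ℕ.* (m ℕ.* m)
  9m²+19m²≡28m² = ℕ-solve-∀
  ∣2u+v∣≤3m : ∣ + 2 * u + v ∣ ℕ.≤ 2 ℕ.* m ℕ.+ m
  ∣2u+v∣≤3m = ℕ.≤-trans (ℤ.∣i+j∣≤∣i∣+∣j∣ (+ 2 * u) v)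
                (subst (λ z → z ℕ.+ ∣ v ∣ ℕ.≤ 2 ℕ.* m ℕ.+ m) (sym (ℤ.abs-* (+ 2) u))
                  (ℕ.+-mono-≤ (ℕ.*-monoʳ-≤ 2 ∣u∣≤m) ∣v∣≤m))

norm-positive : ∀ {u v} → ¬ (u ≡ + 0 × v ≡ + 0) → 0 ℕ.< norm u v
norm-positive {u} {v} nonzero = ℕ.n≢0⇒n>0 λ norm≡0 → nonzero (u≡0 norm≡0 , v≡0 norm≡0)
  where
  square≡0 : ∀ x → ∣ x ∣ ℕ.* ∣ x ∣ ≡ 0 → x ≡ + 0
  square≡0 x eq = ℤ.∣i∣≡0⇒i≡0 ([ (λ z → z) , (λ z → z) ]′ (ℕ.m*n≡0⇒m≡0∨n≡0 ∣ x ∣ eq))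
  cancel : ∀ k {z} → suc k ℕ.* z ≡ 0 → z ≡ 0
  cancel k {z} eq = ℕ.*-cancelˡ-≡ z 0 (suc k) (trans eq (sym (ℕ.*-zeroʳ (suc k))))
  v≡0 : norm u v ≡ 0 → v ≡ + 0
  v≡0 eq = square≡0 v (cancel 18 (ℕ.m+n≡0⇒n≡0 (∣ + 2 * u + v ∣ ℕ.* ∣ + 2 * u + v ∣) eq))
  u≡0 : norm u v ≡ 0 → u ≡ + 0
  u≡0 eq = ℤ.∣i∣≡0⇒i≡0 (cancel 1 (trans (sym (ℤ.abs-* (+ 2) u)) (cong ∣_∣ 2u≡0)))
    where
    2u≡0 : + 2 * u ≡ + 0
    2u≡0 = begin
      + 2 * u       ≡⟨ sym (ℤ.+-identityʳ _) ⟩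
      + 2 * u + + 0 ≡⟨ cong (λ z → + 2 * u + z) (sym (v≡0 eq)) ⟩
      + 2 * u + v   ≡⟨ square≡0 _ (ℕ.m+n≡0⇒m≡0 _ eq) ⟩
      + 0           ∎
      where open ≡-Reasoning

Q-common-factor : ∀ k {u v} → k ∣ₛ u → k ∣ₛ v → ∃₂ λ u′ v′ → Q u v ≡ k * (k * Q u′ v′)
Q-common-factor k (divides u′ refl) (divides v′ refl) = u′ , v′ , Q-scale u′ v′ k

Q-cancel-anisotropic : ∀ n .{{_ : ℕ.NonZero n}} → (∀ x y → + n ∣ₛ Q x y → + n ∣ₛ x × + n ∣ₛ y) →
                       ∀ u v {N} → Q u v ≡ + n * N → ∃₂ λ u′ v′ → + n * Q u′ v′ ≡ N
Q-cancel-anisotropic n anisotropic u v {N} Q≡nN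
  with Q-common-factor (+ n) (proj₁ n∣u,v) (proj₂ n∣u,v)
  where
  n∣u,v : + n ∣ₛ u × + n ∣ₛ v
  n∣u,v = anisotropic u v (divides N (trans Q≡nN (ℤ.*-comm (+ n) N)))
... | u′ , v′ , Q≡nnQ′ = u′ , v′ , ℤ.*-cancelˡ-≡ (+ n) _ _ (trans (sym Q≡nnQ′) Q≡nN)

Q-cancel-prime : ∀ {p} → Prime p → ∀ c d {W} → + p ∣ₛ d → Q c d ≡ + p * W → ∃₂ λ x y → W ≡ + p * Q x y
Q-cancel-prime {p} pr c d {W} p∣d Q≡pW with Q-common-factor (+ p) p∣c p∣d
  where
  p∣c : + p ∣ₛ c
  p∣c = prime∣square⇒∣ pr c (∣m+n∣n⇒∣m (subst (+ p ∣ₛ_) (Q-split-square c d) (divides W (trans Q≡pW (ℤ.*-comm (+ p) W))))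
                                       (∣m⇒∣m*n (c + + 5 * d) p∣d))
... | x , y , Q≡ppQ = x , y , sym (ℤ.*-cancelˡ-≡ (+ p) _ _ {{prime⇒nonZero pr}} (trans (sym Q≡ppQ) Q≡pW))

prime[5] : Prime 5
prime[5] = toWitness {a? = prime? 5} _

-- j = 2, 3, 6 are impossible as Q is anisotropic modulo 2 and 3, j = 4 halves (u, v), and j = 5 uses 5 ∣ u (u + v).
represented-from-small-multiple : ∀ {p} → Prime p → p ≢ 2 → p ≢ 3 →
  ∀ u v j → 0 ℕ.< j → j ℕ.< 7 → Q u v ≡ + j * + p → Represented (+ p)
represented-from-small-multiple {p} pr p≢2 p≢3 u v j 0<j j<7 Q≡jp = by-cases j 0<j j<7 Q≡jp
  where
  2∤p : ¬ (+ 2 ∣ₛ + p)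
  2∤p 2∣p = [ (λ ()) , (λ 2≡p → p≢2 (sym 2≡p)) ]′ (prime⇒irreducible pr (∣⇒∣ᵤ 2∣p))
  3∤p : ¬ (+ 3 ∣ₛ + p)
  3∤p 3∣p = [ (λ ()) , (λ 3≡p → p≢3 (sym 3≡p)) ]′ (prime⇒irreducible pr (∣⇒∣ᵤ 3∣p))
  ∣-witness : ∀ {k x y} → k * x ≡ y → k ∣ₛ y
  ∣-witness {k} {x} kx≡y = divides x (trans (sym kx≡y) (ℤ.*-comm k x))
  by-cases : ∀ j → 0 ℕ.< j → j ℕ.< 7 → Q u v ≡ + j * + p → Represented (+ p)
  by-cases 1 _ _ Q≡p = u , v , sym (trans Q≡p (ℤ.*-identityˡ (+ p)))
  by-cases 2 _ _ Q≡2p =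
    let _ , _ , 2Q′≡p = Q-cancel-anisotropic 2 Q-anisotropic-mod-2 u v Q≡2p in ⊥-elim (2∤p (∣-witness 2Q′≡p))
  by-cases 3 _ _ Q≡3p =
    let _ , _ , 3Q′≡p = Q-cancel-anisotropic 3 Q-anisotropic-mod-3 u v Q≡3p in ⊥-elim (3∤p (∣-witness 3Q′≡p))
  by-cases 4 _ _ Q≡4p =
    let u′ , v′ , 2Q′≡2p = Q-cancel-anisotropic 2 Q-anisotropic-mod-2 u v (trans Q≡4p (ℤ.*-assoc (+ 2) (+ 2) (+ p)))
    in u′ , v′ , sym (ℤ.*-cancelˡ-≡ (+ 2) _ _ 2Q′≡2p)
  by-cases 5 _ _ Q≡5p = [ 5∣u , 5∣u+v ]′ (euclidsLemmaℤ prime[5] u (u + v) 5∣u[u+v])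
    where
    5∣u[u+v] : + 5 ∣ₛ u * (u + v)
    5∣u[u+v] = ∣m+n∣n⇒∣m (subst (+ 5 ∣ₛ_) (Q-split-5 u v) (∣-witness {x = + p} (sym Q≡5p))) (∣m⇒∣m*n (v * v) ∣-refl)
    5∣u : + 5 ∣ₛ u → Represented (+ p)
    5∣u (divides a refl) = a + v , - a , ℤ.*-cancelˡ-≡ (+ 5) _ _ (trans (sym Q≡5p) (Q-5∣first a v))
    5∣u+v : + 5 ∣ₛ u + v → Represented (+ p)
    5∣u+v (divides b u+v≡5b) =
      - v , b , ℤ.*-cancelˡ-≡ (+ 5) _ _ (trans (sym Q≡5p) (trans (cong (λ z → Q z v) u≡5b-v) (Q-5∣sum b v)))
      where
      u≡5b-v : u ≡ b * + 5 - v
      u≡5b-v = trans (shift u v) (cong (_- v) u+v≡5b)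
        where
        shift : ∀ u v → u ≡ (u + v) - v
        shift = solve-∀
  by-cases 6 _ _ Q≡6p =
    let _ , _ , 2Q′≡3p = Q-cancel-anisotropic 2 Q-anisotropic-mod-2 u v (trans Q≡6p (ℤ.*-assoc (+ 2) (+ 3) (+ p)))
    in ⊥-elim ([ ∤-by-computation , 2∤p ]′ (euclidsLemmaℤ prime[2] (+ 3) (+ p) (∣-witness 2Q′≡3p)))
  by-cases (suc (suc (suc (suc (suc (suc (suc _))))))) _ (s≤s (s≤s (s≤s (s≤s (s≤s (s≤s (s≤s ()))))))) _

nonnegative-multiple : ∀ {p N} j → .{{ℕ.NonZero p}} → + 4 * (j * + p) ≡ + N → ∃[ k ] j ≡ + k
nonnegative-multiple {suc _} (+ k) _ = k , refl
nonnegative-multiple {suc _} -[1+ _ ] ()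

multiple-bounds : ∀ {p m k N} → m ℕ.* m ℕ.< p → 4 ℕ.* (k ℕ.* p) ≡ N → 0 ℕ.< N → N ℕ.≤ 28 ℕ.* (m ℕ.* m) →
                  0 ℕ.< k × k ℕ.< 7
multiple-bounds {p} {m} {zero} _ refl () _
multiple-bounds {p} {m} {suc k} m²<p refl _ N≤28m² = s≤s z≤n ,
  ℕ.*-cancelʳ-< p (suc k) 7 (ℕ.*-cancelˡ-< 4 _ _
    (ℕ.≤-<-trans N≤28m² (subst (28 ℕ.* (m ℕ.* m) ℕ.<_) (28p≡4[7p] p) (ℕ.*-monoʳ-< 28 m²<p))))
  where
  28p≡4[7p] : ∀ p → 28 ℕ.* p ≡ 4 ℕ.* (7 ℕ.* p)
  28p≡4[7p] = ℕ-solve-∀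

-- Q u v = j p with 0 < 4 j p = (2u + v)² + 19 v² ≤ 28 m² < 28 p, so 0 < j < 7.
small-divisor-prime-represented : ∀ {p m u v} → Prime p → p ≢ 2 → p ≢ 3 → m ℕ.* m ℕ.< p →
  ¬ (u ≡ + 0 × v ≡ + 0) → ∣ u ∣ ℕ.≤ m → ∣ v ∣ ℕ.≤ m → + p ∣ₛ Q u v → Represented (+ p)
small-divisor-prime-represented {p} {m} {u} {v} pr p≢2 p≢3 m²<p nonzero ∣u∣≤m ∣v∣≤m (divides j Q≡jp) =
  from-nonnegative (nonnegative-multiple j {{prime⇒nonZero pr}} (trans (cong (+ 4 *_) (sym Q≡jp)) (4Q≡norm u v)))
  where
  from-nonnegative : ∃[ k ] j ≡ + k → Represented (+ p)
  from-nonnegative (k , refl) =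
    let 0<k , k<7 = multiple-bounds {p} {m} m²<p 4kp≡norm (norm-positive nonzero) (norm≤ {u} {v} ∣u∣≤m ∣v∣≤m)
    in represented-from-small-multiple pr p≢2 p≢3 u v k 0<k k<7 Q≡jp
    where
    4kp≡norm : 4 ℕ.* (k ℕ.* p) ≡ norm u v
    4kp≡norm = ℤ.+-injective (begin
      + (4 ℕ.* (k ℕ.* p))  ≡⟨ ℤ.pos-* 4 (k ℕ.* p) ⟩
      + 4 * + (k ℕ.* p)    ≡⟨ cong (+ 4 *_) (ℤ.pos-* k p) ⟩
      + 4 * (+ k * + p)    ≡⟨ cong (+ 4 *_) (sym Q≡jp) ⟩
      + 4 * Q u v          ≡⟨ 4Q≡norm u v ⟩
      + norm u v           ∎)
      where open ≡-Reasoning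

-- Thue's lemma gives a small (u, v) with p ∣ u t − v w, hence p ∣ t² Q(u, v), while p ∤ t.
prime-divisor-represented : ∀ {p} → Prime p → ∀ {w t} → + p ∣ₛ Q w t → ¬ (+ p ∣ₛ w × + p ∣ₛ t) → Represented (+ p)
prime-divisor-represented {p} pr {w} {t} p∣Q p∤w,t =
  let m , m²≤p , p<[1+m]² = sqrt-bracket p
      u , v , nonzero , ∣u∣≤m , ∣v∣≤m , p∣ut-vw = thue p m {{prime⇒nonZero pr}} p<[1+m]² w t
      p∣t²Q : + p ∣ₛ t * t * Q u v
      p∣t²Q = subst (+ p ∣ₛ_) (sym (Q-cross u v w t))
                (∣m∣n⇒∣m+n (∣n⇒∣m*n (v * v) p∣Q) (∣m⇒∣m*n (u * t + v * w + v * t) p∣ut-vw))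
  in [ (λ p∣t² → ⊥-elim (p∤t (prime∣square⇒∣ pr t p∣t²)))
     , small-divisor-prime-represented pr p≢2 p≢3 (ℕ.≤∧≢⇒< m²≤p (prime≢square pr m)) nonzero ∣u∣≤m ∣v∣≤m
     ]′ (euclidsLemmaℤ pr (t * t) (Q u v) p∣t²Q)
  where
  p∤t : ¬ (+ p ∣ₛ t)
  p∤t p∣t =
    p∤w,t (prime∣square⇒∣ pr w (∣m+n∣n⇒∣m (subst (+ p ∣ₛ_) (Q-split-square w t) p∣Q) (∣m⇒∣m*n (w + + 5 * t) p∣t)) , p∣t)
  p≢2 : p ≢ 2
  p≢2 refl = p∤w,t (Q-anisotropic-mod-2 w t p∣Q)
  p≢3 : p ≢ 3
  p≢3 refl = p∤w,t (Q-anisotropic-mod-3 w t p∣Q)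

-- p divides a d − b c or a d + b c + b d, the second coordinate of one of the two compositions of (a, b) and (c, d).
Q-cancel-represented-prime : ∀ {p} → Prime p → ∀ a b → + p ≡ Q a b →
  ∀ c d → + p ∣ₛ Q c d → ∃₂ λ x y → Q c d ≡ + p * Q x y
Q-cancel-represented-prime {p} pr a b p≡Qab c d p∣Qcd =
  [ (λ p∣ad-bc → Q-cancel-prime pr (a * c + b * c + + 5 * (b * d)) (a * d - b * c) p∣ad-bc
                   (trans (sym (Q-mul′ a b c d)) (cong (_* Q c d) (sym p≡Qab))))
  , (λ p∣ad+bc+bd → Q-cancel-prime pr (a * c - + 5 * (b * d)) (a * d + b * c + b * d) p∣ad+bc+bd
                       (trans (sym (Q-mul a b c d)) (cong (_* Q c d) (sym p≡Qab))))
  ]′ (euclidsLemmaℤ pr (a * d - b * c) (a * d + b * c + b * d) p∣product)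
  where
  p∣product : + p ∣ₛ (a * d - b * c) * (a * d + b * c + b * d)
  p∣product = ∣m+n∣m⇒∣n (subst (+ p ∣ₛ_) (Q-cross a b c d) (∣n⇒∣m*n (d * d) (subst (+ p ∣ₛ_) p≡Qab ∣-refl)))
                        (∣n⇒∣m*n (b * b) p∣Qcd)

prime-divisor : ∀ n → 1 ℕ.< n → ∃[ p ] (Prime p × p ℕ.∣ n)
prime-divisor n = go n (<-wellFounded n)
  where
  go : ∀ n → Acc ℕ._<_ n → 1 ℕ.< n → ∃[ p ] (Prime p × p ℕ.∣ n)
  go n (acc smaller) 1<n with prime? n
  ... | yes n-prime = n , n-prime , ℕ.∣-refl
  ... | no ¬n-prime with ¬prime⇒composite {{ℕ.n>1⇒nonTrivial 1<n}} ¬n-prime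
  ...   | composite {d} d<n d∣n with go d (smaller d<n) (ℕ.nonTrivial⇒n>1 d)
  ...     | p , p-prime , p∣d = p , p-prime , ℕ.∣-trans p∣d d∣n

Represented-* : ∀ {m n} → Represented (+ m) → Represented (+ n) → Represented (+ (m ℕ.* n))
Represented-* {m} {n} (a , b , m≡Qab) (c , d , n≡Qcd) =
  a * c - + 5 * (b * d) , a * d + b * c + b * d , trans (ℤ.pos-* m n) (trans (cong₂ _*_ m≡Qab n≡Qcd) (Q-mul a b c d))

square-represented : ∀ p → Represented (+ (p ℕ.* p))
square-represented p = + p , + 0 , trans (ℤ.pos-* p p) (expanded (+ p))
  where
  expanded : ∀ x → x * x ≡ x * x + x * + 0 + + 5 * (+ 0 * + 0)
  expanded = solve-∀

cofactor-divisible : ∀ {p A C X} → Prime p → ¬ (p ℕ.∣ C) → + A * + C ≡ + p * X →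
                     ∃[ A′ ] (A ≡ A′ ℕ.* p × + A′ * + C ≡ X)
cofactor-divisible {p} {A} {C} {X} pr p∤C AC≡pX with euclidsLemma A C pr p∣AC
  where
  p∣AC : p ℕ.∣ A ℕ.* C
  p∣AC = subst (p ℕ.∣_) (ℤ.abs-* (+ A) (+ C)) (∣⇒∣ᵤ (divides X (trans AC≡pX (ℤ.*-comm (+ p) X))))
... | inj₂ p∣C = ⊥-elim (p∤C p∣C)
... | inj₁ (ℕ.divides A′ A≡A′p) = A′ , A≡A′p , ℤ.*-cancelˡ-≡ (+ p) _ _ {{prime⇒nonZero pr}} (begin
  + p * (+ A′ * + C)  ≡⟨ rearrange (+ A′) (+ p) (+ C) ⟩
  + A′ * + p * + C    ≡⟨ cong (_* + C) (trans (sym (ℤ.pos-* A′ p)) (cong +_ (sym A≡A′p))) ⟩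
  + A * + C           ≡⟨ AC≡pX ⟩
  + p * X             ∎)
  where
  open ≡-Reasoning
  rearrange : ∀ a p c → p * (a * c) ≡ a * p * c
  rearrange = solve-∀

coprime-factor-represented : ∀ A {C} → Coprime A C → ∀ w t → + A * + C ≡ Q w t → Represented (+ A)
coprime-factor-represented A {C} = go A (<-wellFounded A)
  where
  go : ∀ A → Acc ℕ._<_ A → Coprime A C → ∀ w t → + A * + C ≡ Q w t → Represented (+ A)
  go 0 _ _ _ _ _ = + 0 , + 0 , refl
  go 1 _ _ _ _ _ = + 1 , + 0 , refl
  go A@(suc (suc _)) (acc smaller) A⊥C w t AC≡Q with prime-divisor A (s≤s (s≤s z≤n))
  ... | p , pr , ℕ.divides A₁ A≡A₁p = by-cases ((+ p ∣ₛ? w) ×-dec (+ p ∣ₛ? t))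
    where
    p∤C : ¬ (p ℕ.∣ C)
    p∤C p∣C = ¬prime[1] (subst Prime (A⊥C (ℕ.divides A₁ A≡A₁p , p∣C)) pr)
    pA₁C≡Q : + p * (+ A₁ * + C) ≡ Q w t
    pA₁C≡Q = trans (rearrange (+ A₁) (+ p) (+ C)) (trans (cong (_* + C) (trans (sym (ℤ.pos-* A₁ p)) (cong +_ (sym A≡A₁p)))) AC≡Q)
      where
      rearrange : ∀ a p c → p * (a * c) ≡ a * p * c
      rearrange = solve-∀
    A₁<A : A₁ ℕ.< A
    A₁<A = ℕ.quotient-< (ℕ.divides A₁ A≡A₁p) {{prime⇒nonTrivial pr}}
    A₁⊥C : Coprime A₁ C
    A₁⊥C = coprime-∣ˡ A⊥C (ℕ.divides p (trans A≡A₁p (ℕ.*-comm A₁ p)))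
    by-cases : Dec (+ p ∣ₛ w × + p ∣ₛ t) → Represented (+ A)
    by-cases (yes (p∣w , p∣t)) =
      let w′ , t′ , Q≡ppQ′ = Q-common-factor (+ p) p∣w p∣t
          A₂ , A₁≡A₂p , A₂C≡Q′ =
            cofactor-divisible pr p∤C (ℤ.*-cancelˡ-≡ (+ p) _ _ {{prime⇒nonZero pr}} (trans pA₁C≡Q Q≡ppQ′))
          A₂<A = ℕ.≤-<-trans (ℕ.m≤m*n A₂ p {{prime⇒nonZero pr}}) (subst (ℕ._< A) A₁≡A₂p A₁<A)
          A₂⊥C = coprime-∣ˡ A₁⊥C (ℕ.divides p (trans A₁≡A₂p (ℕ.*-comm A₂ p)))
      in subst Represented (cong +_ (sym (trans A≡A₁p (trans (cong (ℕ._* p) A₁≡A₂p) (ℕ.*-assoc A₂ p p)))))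
           (Represented-* (go A₂ (smaller A₂<A) A₂⊥C w′ t′ A₂C≡Q′) (square-represented p))
    by-cases (no p∤w,t) =
      let a , b , p≡Qab = prime-divisor-represented pr p∣Q p∤w,t
          w′ , t′ , Q≡pQ′ = Q-cancel-represented-prime pr a b p≡Qab w t p∣Q
          A₁C≡Q′ = ℤ.*-cancelˡ-≡ (+ p) _ _ {{prime⇒nonZero pr}} (trans pA₁C≡Q Q≡pQ′)
      in subst Represented (cong +_ (sym A≡A₁p)) (Represented-* (go A₁ (smaller A₁<A) A₁⊥C w′ t′ A₁C≡Q′) (a , b , p≡Qab))
      where
      p∣Q : + p ∣ₛ Q w t
      p∣Q = divides (+ A₁ * + C) (trans (sym pA₁C≡Q) (ℤ.*-comm (+ p) _))

parity : ∀ n → ∃[ q ] (n ≡ q ℕ.+ q ⊎ n ≡ suc (q ℕ.+ q))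
parity zero = 0 , inj₁ refl
parity (suc n) with parity n
... | q , inj₁ n≡2q = q , inj₂ (cong suc n≡2q)
... | q , inj₂ n≡2q+1 = suc q , inj₁ (cong suc (trans n≡2q+1 (sym (ℕ.+-suc q q))))

odd-part : ∀ n → 0 ℕ.< n → ∃[ a ] ∃[ k ] n ≡ 2 ^ a ℕ.* suc (k ℕ.+ k)
odd-part n = go n (<-wellFounded n)
  where
  go : ∀ n → Acc ℕ._<_ n → 0 ℕ.< n → ∃[ a ] ∃[ k ] n ≡ 2 ^ a ℕ.* suc (k ℕ.+ k)
  go n (acc smaller) 0<n with parity n
  ... | k , inj₂ n≡2k+1 = 0 , k , trans n≡2k+1 (sym (ℕ.*-identityˡ _))
  ... | zero , inj₁ refl = ⊥-elim (ℕ.<-irrefl refl 0<n)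
  ... | q@(suc _) , inj₁ n≡2q =
    let a , k , q≡ = go q (smaller (subst (q ℕ.<_) (sym n≡2q) (ℕ.m<m+n q (s≤s z≤n)))) (s≤s z≤n)
    in suc a , k , trans n≡2q (trans (cong (λ m → m ℕ.+ m) q≡) (double (2 ^ a) (suc (k ℕ.+ k))))
    where
    double : ∀ p b → p ℕ.* b ℕ.+ p ℕ.* b ≡ 2 ℕ.* p ℕ.* b
    double = ℕ-solve-∀

no-small-solution : ∀ a b → 0 ℕ.< b → b ℕ.< 39 → a ℕ.* a ≢ 1 ℕ.+ 19 ℕ.* (b ℕ.* b)
no-small-solution a b 0<b b<39 a²≡1+19b² =
  checked (fromℕ< b<39) (fromℕ< a<170) (subst (0 ℕ.<_) (sym (Fin.toℕ-fromℕ< b<39)) 0<b)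
          (subst₂ (λ a b → a ℕ.* a ≡ 1 ℕ.+ 19 ℕ.* (b ℕ.* b))
            (sym (Fin.toℕ-fromℕ< a<170)) (sym (Fin.toℕ-fromℕ< b<39)) a²≡1+19b²)
  where
  checked : ∀ (b : Fin 39) (a : Fin 170) → 0 ℕ.< toℕ b → toℕ a ℕ.* toℕ a ≢ 1 ℕ.+ 19 ℕ.* (toℕ b ℕ.* toℕ b)
  checked = toWitness {a? = Fin.all? λ b → Fin.all? λ a →
    (0 ℕ.<? toℕ b) →-dec ¬? (toℕ a ℕ.* toℕ a ℕ.≟ 1 ℕ.+ 19 ℕ.* (toℕ b ℕ.* toℕ b))} _
  a<170 : a ℕ.< 170
  a<170 = square-reflects-< (ℕ.≤-<-trans (ℕ.≤-reflexive a²≡1+19b²)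
            (ℕ.≤-<-trans (ℕ.+-monoʳ-≤ 1 (ℕ.*-monoʳ-≤ 19 (ℕ.*-mono-≤ b≤38 b≤38)))
              (toWitness {a? = 1 ℕ.+ 19 ℕ.* (38 ℕ.* 38) ℕ.<? 170 ℕ.* 170} _)))
    where
    b≤38 : b ℕ.≤ 38
    b≤38 = ℕ.≤-pred b<39

open PellDescent 19 169 39 refl (s≤s z≤n) no-small-solution

SystemSolution : ℕ → Set
SystemSolution N = ∃[ X ] ∃[ Y ] ∃[ r ] ∃[ s ] ∃[ v ] ∃[ u ]
  ( X * X - + 19 * + (39 ^ 2) * (Y * Y) ≡ + 1
  × X + + (13 ^ 2) * Y ≡ Q r s
  × X + + 19 * + (3 ^ 2) * Y ≡ Q v u
  × Y > + 0
  × ((r ≢ + 1 × r ≢ - + 1) ⊎ s ≢ + 0)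
  × (+ 39 * (X + + (13 ^ 2) * Y) * (X + + 19 * + (3 ^ 2) * Y)) ∣ + N )

pell-ℤ : ∀ {D x z} → x ℕ.* x ≡ 1 ℕ.+ D ℕ.* (z ℕ.* z) → + x * + x - + D * (+ z * + z) ≡ + 1
pell-ℤ {D} {x} {z} x²≡1+Dz² = begin
  + x * + x - + D * (+ z * + z)              ≡⟨ cong₂ (λ a b → a - + D * b) (sym (ℤ.pos-* x x)) (sym (ℤ.pos-* z z)) ⟩
  + (x ℕ.* x) - + D * + (z ℕ.* z)            ≡⟨ cong₂ (λ a b → a - b) (cong +_ x²≡1+Dz²) (sym (ℤ.pos-* D (z ℕ.* z))) ⟩
  + (1 ℕ.+ D ℕ.* (z ℕ.* z)) - + (D ℕ.* (z ℕ.* z)) ≡⟨ cong (_- + (D ℕ.* (z ℕ.* z))) (ℤ.pos-+ 1 (D ℕ.* (z ℕ.* z))) ⟩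
  + 1 + + (D ℕ.* (z ℕ.* z)) - + (D ℕ.* (z ℕ.* z)) ≡⟨ cancel (+ 1) (+ (D ℕ.* (z ℕ.* z))) ⟩
  + 1                                         ∎
  where
  open ≡-Reasoning
  cancel : ∀ a b → a + b - b ≡ a
  cancel = solve-∀

+-linear : ∀ x k z → + x + + k * + z ≡ + (x ℕ.+ k ℕ.* z)
+-linear x k z = trans (cong (λ y → + x + y) (sym (ℤ.pos-* k z))) (sym (ℤ.pos-+ x (k ℕ.* z)))

nontrivial-representation : ∀ {A r s} → 1 ℕ.< A → + A ≡ Q r s → (r ≢ + 1 × r ≢ - + 1) ⊎ s ≢ + 0
nontrivial-representation {A} {r} {s} 1<A A≡Q with s ℤ.≟ + 0
... | no s≢0 = inj₂ s≢0
... | yes refl = inj₁ ((λ { refl → A≢1 (ℤ.+-injective A≡Q) }) , (λ { refl → A≢1 (ℤ.+-injective A≡Q) }))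
  where
  A≢1 : A ≢ 1
  A≢1 refl = ℕ.<-irrefl refl 1<A

system-solution : ∀ {n} a k → n ≡ 2 ^ a ℕ.* suc (suc k ℕ.+ suc k) → ∀ w t → Q w t ≡ + Z n → SystemSolution (39 ℕ.* Z n)
system-solution {n} a k n≡2^a[2K+1] w t Q≡Zn = from-cofactor (Z-odd-multiple K a)
  where
  K = suc k
  A = X K ℕ.+ 169 ℕ.* Z K
  B = X K ℕ.+ 171 ℕ.* Z K
  1<A : 1 ℕ.< A
  1<A = ℕ.<-≤-trans (s≤s (s≤s z≤n))
          (ℕ.≤-trans (ℕ.m≤m*n 169 (Z K) {{ℕ.>-nonZero (Z-suc-positive k)}}) (ℕ.m≤n+m (169 ℕ.* Z K) (X K)))
  from-cofactor : ∃[ C ] (Z (2 ^ a ℕ.* suc (K ℕ.+ K)) ≡ Z (suc (K ℕ.+ K)) ℕ.* C × Coprime (Z (suc (K ℕ.+ K))) C) →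
                  SystemSolution (39 ℕ.* Z n)
  from-cofactor (C , Z[N]≡Z[b]C , Z[b]⊥C) =
    let A⊥BC , B⊥AC = odd-factors-coprime-to-cofactor K Z[b]⊥C
        r , s , A≡Qrs = coprime-factor-represented A A⊥BC w t (sym (trans Q≡Zn (+-product A (B ℕ.* C) Zn≡ABC)))
        v , u , B≡Qvu = coprime-factor-represented B B⊥AC w t (sym (trans Q≡Zn (+-product B (A ℕ.* C) (trans Zn≡ABC (swap A B C)))))
    in + X K , + Z K , r , s , v , u , pell-ℤ {19 ℕ.* (39 ℕ.* 39)} {X K} {Z K} (pell K) , trans (+-linear (X K) 169 (Z K)) A≡Qrs ,
       trans (+-linear (X K) 171 (Z K)) B≡Qvu , +<+ (Z-suc-positive k) , nontrivial-representation 1<A A≡Qrs ,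
       subst (_∣ + (39 ℕ.* Z n)) (sym 39AB≡) (ℕ.divides C (trans (cong (39 ℕ.*_) Zn≡ABC) (regroup 39 A B C)))
    where
    Zn≡ABC : Z n ≡ A ℕ.* (B ℕ.* C)
    Zn≡ABC = trans (cong Z n≡2^a[2K+1]) (trans Z[N]≡Z[b]C
               (trans (cong (ℕ._* C) (Z-odd-factorisation K)) (ℕ.*-assoc A B C)))
    +-product : ∀ {m} n o → m ≡ n ℕ.* o → + m ≡ + n * + o
    +-product n o m≡no = trans (cong +_ m≡no) (ℤ.pos-* n o)
    swap : ∀ a b c → a ℕ.* (b ℕ.* c) ≡ b ℕ.* (a ℕ.* c)
    swap = ℕ-solve-∀
    regroup : ∀ x a b c → x ℕ.* (a ℕ.* (b ℕ.* c)) ≡ c ℕ.* (x ℕ.* a ℕ.* b)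
    regroup = ℕ-solve-∀
    39AB≡ : + 39 * (+ X K + + (13 ^ 2) * + Z K) * (+ X K + + 19 * + (3 ^ 2) * + Z K) ≡ + (39 ℕ.* A ℕ.* B)
    39AB≡ = trans (cong₂ (λ p q → + 39 * p * q) (+-linear (X K) 169 (Z K)) (+-linear (X K) 171 (Z K)))
                  (sym (trans (ℤ.pos-* (39 ℕ.* A) B) (cong (_* + B) (ℤ.pos-* 39 A))))

theorem1 : (x y : ℕ → ℕ)
    → (∀ k → x k ℕ.* x k ≡ 1 ℕ.+ 19 ℕ.* (y k ℕ.* y k))
    → (∀ k → y k ℕ.< y (ℕ.suc k))
    → (∀ a b → a ℕ.* a ≡ 1 ℕ.+ 19 ℕ.* (b ℕ.* b) → ∃[ k ] (x k ≡ a × y k ≡ b))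
    → (n : ℕ) → 0 ℕ.< n → ¬ (∃[ j ] n ≡ 2 ^ j)
    → (∃[ m ] (+ y n ≡ + 39 * m × Representable m))
    → ∃[ X ] ∃[ Y ] ∃[ r ] ∃[ s ] ∃[ v ] ∃[ u ]
        ( X * X - + 19 * + (39 ^ 2) * (Y * Y) ≡ + 1
        × X + + (13 ^ 2) * Y ≡ Q r s
        × X + + 19 * + (3 ^ 2) * Y ≡ Q v u
        × Y > + 0
        × ((r ≢ + 1 × r ≢ - + 1) ⊎ s ≢ + 0)
        × (+ 39 * (X + + (13 ^ 2) * Y) * (X + + 19 * + (3 ^ 2) * Y)) ∣ + y n )
theorem1 x y pell-xy y↑ complete n 0<n n≢2^j (m , yn≡39m , _ , w , t , m≡Q) =
  subst SystemSolution (sym yn≡39Zn) (from-odd-part (odd-part n 0<n))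
  where
  yn≡39Zn : y n ≡ 39 ℕ.* Z n
  yn≡39Zn = enumeration-unique x y pell-xy y↑ complete n
  Q≡Zn : Q w t ≡ + Z n
  Q≡Zn = trans (sym m≡Q) (ℤ.*-cancelˡ-≡ (+ 39) m (+ Z n) (trans (sym yn≡39m) (trans (cong +_ yn≡39Zn) (ℤ.pos-* 39 (Z n)))))
  from-odd-part : ∃[ a ] ∃[ k ] n ≡ 2 ^ a ℕ.* suc (k ℕ.+ k) → SystemSolution (39 ℕ.* Z n)
  from-odd-part (a , zero , n≡2^a) = ⊥-elim (n≢2^j (a , trans n≡2^a (ℕ.*-identityʳ (2 ^ a))))
  from-odd-part (a , suc k , n≡2^a[2K+1]) = system-solution a k n≡2^a[2K+1] w t Q≡Zn
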